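{- For an integer $n \ge 0$, let $X_n$ be a uniformly random binary string of length $n$, and let $N_n$ be the total number of distinct subsequences of $X_n$ (of all lengths, including the empty subsequence). Then \[ \mathbb{E}[N_n] = 2\left(\tfrac{3}{2}\right)^n - 1 . \]
   Context: A subsequence of a string $s = s_0 s_1\cdots s_{n-1}$ is a string $s_{i_1}s_{i_2}\cdots s_{i_k}$ with $k\ge 0$ and $0\le i_1<\dots<i_k\le n-1$ (not necessarily contiguous). Subsequences are counted as distinct strings, i.e. different index choices yielding the same string are counted once. -}

module Defs where

open import Data.Bool using (Bool; true; false)
open import Data.Bool.Properties using () renaming (_≟_ to _≟ᵇ_)
open import Data.Nat using (ℕ; zero; suc)
open import Data.List using (List; []; _∷_; map; _++_; length; filter; upTo)
open import Data.Nat.ListAction using (sum)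
open import Data.List.Relation.Binary.Sublist.DecPropositional _≟ᵇ_ using (_⊆_; _⊆?_)
open import Data.Rational using (ℚ; 1ℚ; _*_; _/_)
open import Data.Integer using (+_)

allStrings : ℕ → List (List Bool)
allStrings zero    = [] ∷ []
allStrings (suc n) = map (false ∷_) (allStrings n) ++ map (true ∷_) (allStrings n)

numDistinctSubseq : List Bool → ℕ
numDistinctSubseq s =
  sum (map (λ k → length (filter (λ t → t ⊆? s) (allStrings k))) (upTo (suc (length s))))

_^ℚ_ : ℚ → ℕ → ℚ
q ^ℚ zero  = 1ℚ
q ^ℚ suc n = q * (q ^ℚ n)

expectUniform : ℕ → (List Bool → ℕ) → ℚ
expectUniform n f = ((+ sum (map f (allStrings n))) / 1) * ((+ 1 / 2) ^ℚ n)

module Submission where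

-- Write N(s) for the number of distinct subsequences of a binary string s.
-- Counting the pairs (t, s) with t a subsequence of s by t instead of by s,
--   Σ_{s ∈ {0,1}ⁿ} N(s) = Σ_{k ≤ n} Σ_{t ∈ {0,1}ᵏ} #{ s ∈ {0,1}ⁿ : t ⊆ s }.
-- The inner count depends only on k = |t|.  Splitting s by its first letter (which
-- either matches the first letter of t or is skipped) shows that it equals the
-- supersequence number S(k,n) given by
--   S(0,n) = 2ⁿ,   S(k+1,0) = 0,   S(k+1,n+1) = S(k,n) + S(k+1,n).
-- So the total is W(n) = Σ_{k ≤ n} 2ᵏ S(k,n), and the recursion for S yields
-- W(n+1) + 2ⁿ⁺¹ = 3 (W(n) + 2ⁿ), i.e. W(n) = 2·3ⁿ − 2ⁿ.

module Sums where

  open import Data.Nat using (ℕ; suc; _+_; _*_)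
  open import Data.Nat.Properties using (*-distribˡ-+; *-zeroʳ; +-identityʳ; +-commutativeSemigroup)
  open import Algebra.Properties.CommutativeSemigroup +-commutativeSemigroup using (interchange)
  open import Data.List using (List; []; _∷_; map; _++_; length; upTo)
  open import Data.List.Properties using (map-++; map-∘; map-upTo; upTo-∷ʳ)
  open import Data.Nat.ListAction using (sum)
  open import Data.Nat.ListAction.Properties using (sum-++)
  open import Data.List.Relation.Unary.All using (All; []; _∷_)
  open import Relation.Binary.PropositionalEquality
  open import Function using (_∘_)

  ∑ : {A : Set} → List A → (A → ℕ) → ℕ
  ∑ xs f = sum (map f xs)

  ∑-cong-All : ∀ {A : Set} {P : A → Set} {f g : A → ℕ} {xs : List A} →
    All P xs → (∀ {x} → P x → f x ≡ g x) → ∑ xs f ≡ ∑ xs g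
  ∑-cong-All []         eq = refl
  ∑-cong-All (px ∷ pxs) eq = cong₂ _+_ (eq px) (∑-cong-All pxs eq)

  ∑-cong : ∀ {A : Set} {f g : A → ℕ} (xs : List A) → (∀ x → f x ≡ g x) → ∑ xs f ≡ ∑ xs g
  ∑-cong []       eq = refl
  ∑-cong (x ∷ xs) eq = cong₂ _+_ (eq x) (∑-cong xs eq)

  ∑-+ : ∀ {A : Set} (xs : List A) (f g : A → ℕ) →
    ∑ xs (λ x → f x + g x) ≡ ∑ xs f + ∑ xs g
  ∑-+ []       f g = refl
  ∑-+ (x ∷ xs) f g = trans (cong (f x + g x +_) (∑-+ xs f g)) (interchange (f x) (g x) _ _)

  ∑-*ˡ : ∀ {A : Set} (xs : List A) (c : ℕ) (f : A → ℕ) →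
    ∑ xs (λ x → c * f x) ≡ c * ∑ xs f
  ∑-*ˡ []       c f = sym (*-zeroʳ c)
  ∑-*ˡ (x ∷ xs) c f = trans (cong (c * f x +_) (∑-*ˡ xs c f)) (sym (*-distribˡ-+ c (f x) _))

  ∑-const : ∀ {A : Set} (xs : List A) (c : ℕ) → ∑ xs (λ _ → c) ≡ length xs * c
  ∑-const []       c = refl
  ∑-const (x ∷ xs) c = cong (c +_) (∑-const xs c)

  ∑-comm : ∀ {A B : Set} (xs : List A) (ys : List B) (f : A → B → ℕ) →
    ∑ xs (λ x → ∑ ys (f x)) ≡ ∑ ys (λ y → ∑ xs (λ x → f x y))
  ∑-comm []       ys f = sym (trans (∑-const ys 0) (*-zeroʳ (length ys)))
  ∑-comm (x ∷ xs) ys f =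
    trans (cong (∑ ys (f x) +_) (∑-comm xs ys f)) (sym (∑-+ ys (f x) _))

  ∑-++ : ∀ {A : Set} (xs ys : List A) (f : A → ℕ) → ∑ (xs ++ ys) f ≡ ∑ xs f + ∑ ys f
  ∑-++ xs ys f = trans (cong sum (map-++ f xs ys)) (sum-++ (map f xs) (map f ys))

  ∑-map : ∀ {A B : Set} (g : A → B) (xs : List A) (f : B → ℕ) →
    ∑ (map g xs) f ≡ ∑ xs (f ∘ g)
  ∑-map g xs f = cong sum (sym (map-∘ xs))

  ∑-upTo-first : ∀ m (f : ℕ → ℕ) → ∑ (upTo (suc m)) f ≡ f 0 + ∑ (upTo m) (f ∘ suc)
  ∑-upTo-first m f = cong (f 0 +_) (trans (cong (λ ks → ∑ ks f) (sym (map-upTo suc m))) (∑-map suc (upTo m) f))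

  ∑-upTo-last : ∀ m (f : ℕ → ℕ) → ∑ (upTo (suc m)) f ≡ ∑ (upTo m) f + f m
  ∑-upTo-last m f = begin
    ∑ (upTo (suc m)) f           ≡⟨ cong (λ ks → ∑ ks f) (sym (upTo-∷ʳ m)) ⟩
    ∑ (upTo m ++ m ∷ []) f       ≡⟨ ∑-++ (upTo m) (m ∷ []) f ⟩
    ∑ (upTo m) f + (f m + 0)     ≡⟨ cong (∑ (upTo m) f +_) (+-identityʳ (f m)) ⟩
    ∑ (upTo m) f + f m           ∎
    where open ≡-Reasoning

module Counting where

  open import Defs using (allStrings; numDistinctSubseq)
  open Sums
  open import Data.Bool using (Bool; true; false; if_then_else_)
  open import Data.Bool.Properties using () renaming (_≟_ to _≟ᵇ_)
  open import Data.Nat using (ℕ; zero; suc; _+_; _*_; _^_; _<_; s<s)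
  open import Data.Nat.Properties using (+-comm; +-identityʳ; *-identityʳ; m<n⇒m<1+n)
  open import Data.List using (List; []; _∷_; map; _++_; length; filter; upTo)
  open import Data.List.Properties using (length-++; length-map)
  open import Data.List.Relation.Unary.All using (All; []; _∷_)
  import Data.List.Relation.Unary.All as All
  open import Data.List.Relation.Unary.All.Properties using (++⁺; map⁺)
  open import Data.List.Relation.Binary.Sublist.DecPropositional _≟ᵇ_ using (_⊆?_)
  open import Data.List.Relation.Binary.Sublist.Heterogeneous.Properties
    using (∷⁻¹; ∷ʳ⁻¹; Sublist-[]-universal)
  open import Function.Bundles using (_⇔_)
  open import Relation.Nullary using (Dec; does; ¬_)
  open import Relation.Nullary.Decidable using (does-⇔; dec-true)
  open import Relation.Unary using (Decidable)
  open import Relation.Binary.PropositionalEquality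

  𝟙 : ∀ {p} {P : Set p} → Dec P → ℕ
  𝟙 P? = if does P? then 1 else 0

  𝟙-holds : ∀ {p} {P : Set p} (P? : Dec P) → P → 𝟙 P? ≡ 1
  𝟙-holds P? p = cong (λ b → if b then 1 else 0) (dec-true P? p)

  𝟙-⇔ : ∀ {p q} {P : Set p} {Q : Set q} → P ⇔ Q → (P? : Dec P) (Q? : Dec Q) → 𝟙 P? ≡ 𝟙 Q?
  𝟙-⇔ P⇔Q P? Q? = cong (λ b → if b then 1 else 0) (does-⇔ P⇔Q P? Q?)

  length-filter : ∀ {A : Set} {P : A → Set} (P? : Decidable P) (xs : List A) →
    length (filter P? xs) ≡ ∑ xs (λ x → 𝟙 (P? x))
  length-filter P? []       = refl
  length-filter P? (x ∷ xs) with does (P? x)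
  ... | true  = cong suc (length-filter P? xs)
  ... | false = length-filter P? xs

  allStrings-length : ∀ n → All (λ s → length s ≡ n) (allStrings n)
  allStrings-length zero    = refl ∷ []
  allStrings-length (suc n) = ++⁺ (map⁺ lengthen) (map⁺ lengthen)
    where
    lengthen : All (λ s → suc (length s) ≡ suc n) (allStrings n)
    lengthen = All.map (cong suc) (allStrings-length n)

  length-allStrings : ∀ n → length (allStrings n) ≡ 2 ^ n
  length-allStrings zero    = refl
  length-allStrings (suc n) = begin
    length (map (false ∷_) (allStrings n) ++ map (true ∷_) (allStrings n))
      ≡⟨ length-++ (map (false ∷_) (allStrings n)) ⟩
    length (map (false ∷_) (allStrings n)) + length (map (true ∷_) (allStrings n))
      ≡⟨ cong₂ _+_ (length-map (false ∷_) (allStrings n)) (length-map (true ∷_) (allStrings n)) ⟩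
    length (allStrings n) + length (allStrings n)
      ≡⟨ cong (λ m → m + m) (length-allStrings n) ⟩
    2 ^ n + 2 ^ n
      ≡⟨ cong (2 ^ n +_) (sym (+-identityʳ (2 ^ n))) ⟩
    2 ^ suc n ∎
    where open ≡-Reasoning

  ∑-allStrings-suc : ∀ n (f : List Bool → ℕ) →
    ∑ (allStrings (suc n)) f ≡ ∑ (allStrings n) (λ s → f (false ∷ s)) + ∑ (allStrings n) (λ s → f (true ∷ s))
  ∑-allStrings-suc n f =
    trans (∑-++ (map (false ∷_) (allStrings n)) _ f)
          (cong₂ _+_ (∑-map (false ∷_) (allStrings n) f) (∑-map (true ∷_) (allStrings n) f))

  -- S k n: the number of strings of length n containing a fixed string of length k
  -- as a subsequence (that this is independent of the fixed string is count≡S).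
  S : ℕ → ℕ → ℕ
  S zero    n       = 2 ^ n
  S (suc k) zero    = 0
  S (suc k) (suc n) = S k n + S (suc k) n

  S-vanish : ∀ {k n} → n < k → S k n ≡ 0
  S-vanish {suc k} {zero}  _         = refl
  S-vanish {suc k} {suc n} (s<s n<k) = cong₂ _+_ (S-vanish n<k) (S-vanish (m<n⇒m<1+n n<k))

  count : List Bool → ℕ → ℕ
  count t n = ∑ (allStrings n) (λ s → 𝟙 (t ⊆? s))

  match : ∀ (a : Bool) t s → 𝟙 ((a ∷ t) ⊆? (a ∷ s)) ≡ 𝟙 (t ⊆? s)
  match a t s = sym (𝟙-⇔ (∷⁻¹ refl) (t ⊆? s) ((a ∷ t) ⊆? (a ∷ s)))

  skip : ∀ {a b : Bool} → ¬ a ≡ b → ∀ t s → 𝟙 ((a ∷ t) ⊆? (b ∷ s)) ≡ 𝟙 ((a ∷ t) ⊆? s)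
  skip {a} {b} a≢b t s = sym (𝟙-⇔ (∷ʳ⁻¹ a≢b) ((a ∷ t) ⊆? s) ((a ∷ t) ⊆? (b ∷ s)))

  -- The empty string is a subsequence of every string.
  count-[] : ∀ n → count [] n ≡ 2 ^ n
  count-[] n = begin
    ∑ (allStrings n) (λ s → 𝟙 ([] ⊆? s))
      ≡⟨ ∑-cong (allStrings n) (λ s → 𝟙-holds ([] ⊆? s) (Sublist-[]-universal s)) ⟩
    ∑ (allStrings n) (λ _ → 1)           ≡⟨ ∑-const (allStrings n) 1 ⟩
    length (allStrings n) * 1            ≡⟨ cong (_* 1) (length-allStrings n) ⟩
    2 ^ n * 1                            ≡⟨ *-identityʳ (2 ^ n) ⟩
    2 ^ n                                ∎
    where open ≡-Reasoning

  count-∷ : ∀ a t n → count (a ∷ t) (suc n) ≡ count t n + count (a ∷ t) n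
  count-∷ false t n = trans (∑-allStrings-suc n _)
    (cong₂ _+_ (∑-cong (allStrings n) (match false t)) (∑-cong (allStrings n) (skip {false} {true} (λ ()) t)))
  count-∷ true  t n = trans (∑-allStrings-suc n _)
    (trans (cong₂ _+_ (∑-cong (allStrings n) (skip {true} {false} (λ ()) t)) (∑-cong (allStrings n) (match true t)))
           (+-comm (count (true ∷ t) n) (count t n)))

  count≡S : ∀ t n → count t n ≡ S (length t) n
  count≡S []      n       = count-[] n
  count≡S (a ∷ t) zero    = refl
  count≡S (a ∷ t) (suc n) = trans (count-∷ a t n) (cong₂ _+_ (count≡S t n) (count≡S (a ∷ t) n))

  numDistinctSubseq-∑ : ∀ {n} s → length s ≡ n →
    numDistinctSubseq s ≡ ∑ (upTo (suc n)) (λ k → ∑ (allStrings k) (λ t → 𝟙 (t ⊆? s)))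
  numDistinctSubseq-∑ s refl = ∑-cong (upTo (suc (length s))) (λ k → length-filter (_⊆? s) (allStrings k))

  ∑-count : ∀ k n → ∑ (allStrings k) (λ t → count t n) ≡ 2 ^ k * S k n
  ∑-count k n = begin
    ∑ (allStrings k) (λ t → count t n)   ≡⟨ ∑-cong-All (allStrings-length k) (λ {t} |t|≡k → trans (count≡S t n) (cong (λ l → S l n) |t|≡k)) ⟩
    ∑ (allStrings k) (λ _ → S k n)       ≡⟨ ∑-const (allStrings k) (S k n) ⟩
    length (allStrings k) * S k n        ≡⟨ cong (_* S k n) (length-allStrings k) ⟩
    2 ^ k * S k n                        ∎
    where open ≡-Reasoning

  W : ℕ → ℕ
  W n = ∑ (upTo (suc n)) (λ k → 2 ^ k * S k n)

  ∑-numDistinctSubseq : ∀ n → ∑ (allStrings n) numDistinctSubseq ≡ W n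
  ∑-numDistinctSubseq n = begin
    ∑ (allStrings n) numDistinctSubseq
      ≡⟨ ∑-cong-All (allStrings-length n) (numDistinctSubseq-∑ _) ⟩
    ∑ (allStrings n) (λ s → ∑ (upTo (suc n)) (λ k → ∑ (allStrings k) (λ t → 𝟙 (t ⊆? s))))
      ≡⟨ ∑-comm (allStrings n) (upTo (suc n)) _ ⟩
    ∑ (upTo (suc n)) (λ k → ∑ (allStrings n) (λ s → ∑ (allStrings k) (λ t → 𝟙 (t ⊆? s))))
      ≡⟨ ∑-cong (upTo (suc n)) (λ k → ∑-comm (allStrings n) (allStrings k) _) ⟩
    ∑ (upTo (suc n)) (λ k → ∑ (allStrings k) (λ t → count t n))
      ≡⟨ ∑-cong (upTo (suc n)) (λ k → ∑-count k n) ⟩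
    W n ∎
    where open ≡-Reasoning

module Closed-form where

  open Sums
  open Counting using (S; S-vanish; W)
  open import Data.Nat using (ℕ; zero; suc; _+_; _*_; _^_)
  open import Data.Nat.Properties using (*-identityˡ; *-zeroʳ; +-identityʳ; *-distribˡ-+; *-assoc; n<1+n)
  open import Data.List using (upTo)
  open import Data.Nat.Solver using (module +-*-Solver)
  open import Relation.Binary.PropositionalEquality
  open ≡-Reasoning

  -- The part of W n with k ≥ 1, reindexed from k = 0.
  T : ℕ → ℕ
  T n = ∑ (upTo (suc n)) (λ k → 2 ^ suc k * S (suc k) n)

  -- Separating the k = 0 term: extending the range to k = n + 1 adds only
  -- S (n+1) n = 0, and the k = 0 term is S 0 n = 2ⁿ.
  W≡2^n+T : ∀ n → W n ≡ 2 ^ n + T n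
  W≡2^n+T n = begin
    W n                                              ≡⟨ sym (+-identityʳ (W n)) ⟩
    W n + 0                                          ≡⟨ cong (W n +_) (sym (trans (cong (2 ^ suc n *_) (S-vanish (n<1+n n))) (*-zeroʳ (2 ^ suc n)))) ⟩
    W n + 2 ^ suc n * S (suc n) n                    ≡⟨ sym (∑-upTo-last (suc n) (λ k → 2 ^ k * S k n)) ⟩
    ∑ (upTo (suc (suc n))) (λ k → 2 ^ k * S k n)     ≡⟨ ∑-upTo-first (suc n) (λ k → 2 ^ k * S k n) ⟩
    1 * 2 ^ n + T n                                  ≡⟨ cong (_+ T n) (*-identityˡ (2 ^ n)) ⟩
    2 ^ n + T n                                      ∎

  -- One step of the recursion for S, summed with weights 2ᵏ.
  W-suc : ∀ n → W (suc n) ≡ 2 ^ suc n + (2 * W n + T n)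
  W-suc n = begin
    W (suc n)
      ≡⟨ ∑-upTo-first (suc n) (λ k → 2 ^ k * S k (suc n)) ⟩
    1 * 2 ^ suc n + ∑ (upTo (suc n)) (λ k → 2 ^ suc k * (S k n + S (suc k) n))
      ≡⟨ cong₂ _+_ (*-identityˡ (2 ^ suc n)) (∑-cong (upTo (suc n)) split) ⟩
    2 ^ suc n + ∑ (upTo (suc n)) (λ k → 2 * (2 ^ k * S k n) + 2 ^ suc k * S (suc k) n)
      ≡⟨ cong (2 ^ suc n +_) (∑-+ (upTo (suc n)) (λ k → 2 * (2 ^ k * S k n)) (λ k → 2 ^ suc k * S (suc k) n)) ⟩
    2 ^ suc n + (∑ (upTo (suc n)) (λ k → 2 * (2 ^ k * S k n)) + T n)
      ≡⟨ cong (λ x → 2 ^ suc n + (x + T n)) (∑-*ˡ (upTo (suc n)) 2 (λ k → 2 ^ k * S k n)) ⟩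
    2 ^ suc n + (2 * W n + T n) ∎
    where
    split : ∀ k → 2 ^ suc k * (S k n + S (suc k) n) ≡ 2 * (2 ^ k * S k n) + 2 ^ suc k * S (suc k) n
    split k = trans (*-distribˡ-+ (2 ^ suc k) (S k n) _) (cong (_+ 2 ^ suc k * S (suc k) n) (*-assoc 2 (2 ^ k) (S k n)))

  W-step : ∀ n → W (suc n) + 2 ^ suc n ≡ 3 * (W n + 2 ^ n)
  W-step n = begin
    W (suc n) + 2 ^ suc n                        ≡⟨ cong (_+ 2 ^ suc n) (W-suc n) ⟩
    2 * p + (2 * W n + T n) + 2 * p              ≡⟨ cong (λ w → 2 * p + (2 * w + T n) + 2 * p) (W≡2^n+T n) ⟩
    2 * p + (2 * (p + T n) + T n) + 2 * p        ≡⟨ linear p (T n) ⟩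
    3 * ((p + T n) + p)                          ≡⟨ cong (λ w → 3 * (w + p)) (sym (W≡2^n+T n)) ⟩
    3 * (W n + p)                                ∎
    where
    p = 2 ^ n
    open +-*-Solver
    linear : ∀ p t → 2 * p + (2 * (p + t) + t) + 2 * p ≡ 3 * ((p + t) + p)
    linear = solve 2 (λ p t → con 2 :* p :+ (con 2 :* (p :+ t) :+ t) :+ con 2 :* p
                            := con 3 :* ((p :+ t) :+ p)) refl

  W-closed : ∀ n → W n + 2 ^ n ≡ 2 * 3 ^ n
  W-closed zero    = refl
  W-closed (suc n) = begin
    W (suc n) + 2 ^ suc n    ≡⟨ W-step n ⟩
    3 * (W n + 2 ^ n)        ≡⟨ cong (3 *_) (W-closed n) ⟩
    3 * (2 * 3 ^ n)          ≡⟨ sym (*-assoc 3 2 (3 ^ n)) ⟩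
    6 * 3 ^ n                ≡⟨ *-assoc 2 3 (3 ^ n) ⟩
    2 * 3 ^ suc n            ∎

module Rationals where

  open import Defs using (_^ℚ_)
  open import Data.Nat as ℕ using (ℕ; zero; suc)
  open import Data.Nat.Divisibility using (∣1⇒≡1)
  open import Data.Product using (proj₂)
  open import Data.Integer using (+_)
  open import Data.Integer.Properties using (pos-*) renaming (*-identityʳ to ℤ*-identityʳ)
  open import Data.Rational using (ℚ; mkℚ; 1ℚ; _*_; _+_; _-_; _/_)
  open import Data.Rational.Properties using (normalize-coprime; *-identityˡ)
  open import Data.Rational.Solver using (module +-*-Solver)
  open import Relation.Binary.PropositionalEquality
  open ≡-Reasoning
  open +-*-Solver

  ι : ℕ → ℚ
  ι a = + a / 1

  -- a / 1 is already in lowest terms, so ι a is the normal form with numerator a.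
  ι-normal : ∀ a → ι a ≡ mkℚ (+ a) 0 (λ d∣a,1 → ∣1⇒≡1 (proj₂ d∣a,1))
  ι-normal a = normalize-coprime (λ d∣a,1 → ∣1⇒≡1 (proj₂ d∣a,1))

  ι-+ : ∀ a b → ι (a ℕ.+ b) ≡ ι a + ι b
  ι-+ a b rewrite ι-normal a | ι-normal b | ℤ*-identityʳ (+ a) | ℤ*-identityʳ (+ b) = refl

  ι-* : ∀ a b → ι (a ℕ.* b) ≡ ι a * ι b
  ι-* a b rewrite ι-normal a | ι-normal b | sym (pos-* a b) = refl

  ι-^ : ∀ a n → ι (a ℕ.^ n) ≡ ι a ^ℚ n
  ι-^ a zero    = refl
  ι-^ a (suc n) = trans (ι-* a (a ℕ.^ n)) (cong (ι a *_) (ι-^ a n))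

  ^ℚ-distrib-* : ∀ p q n → (p * q) ^ℚ n ≡ p ^ℚ n * q ^ℚ n
  ^ℚ-distrib-* p q zero    = refl
  ^ℚ-distrib-* p q (suc n) = begin
    (p * q) * (p * q) ^ℚ n            ≡⟨ cong ((p * q) *_) (^ℚ-distrib-* p q n) ⟩
    (p * q) * (p ^ℚ n * q ^ℚ n)       ≡⟨ regroup p q (p ^ℚ n) (q ^ℚ n) ⟩
    (p * p ^ℚ n) * (q * q ^ℚ n)       ∎
    where
    regroup : ∀ p q x y → (p * q) * (x * y) ≡ (p * x) * (q * y)
    regroup = solve 4 (λ p q x y → (p :* q) :* (x :* y) := (p :* x) :* (q :* y)) refl

  1^ℚ : ∀ n → 1ℚ ^ℚ n ≡ 1ℚ
  1^ℚ zero    = refl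
  1^ℚ (suc n) = trans (*-identityˡ (1ℚ ^ℚ n)) (1^ℚ n)

  ½ : ℚ
  ½ = + 1 / 2

  [3/2]^n : ∀ n → (+ 3 / 2) ^ℚ n ≡ ι (3 ℕ.^ n) * ½ ^ℚ n
  [3/2]^n n = trans (^ℚ-distrib-* (ι 3) ½ n) (cong (_* ½ ^ℚ n) (sym (ι-^ 3 n)))

  1≡2^n[½]^n : ∀ n → 1ℚ ≡ ι (2 ℕ.^ n) * ½ ^ℚ n
  1≡2^n[½]^n n = begin
    1ℚ                         ≡⟨ sym (1^ℚ n) ⟩
    (ι 2 * ½) ^ℚ n             ≡⟨ ^ℚ-distrib-* (ι 2) ½ n ⟩
    ι 2 ^ℚ n * ½ ^ℚ n          ≡⟨ cong (_* ½ ^ℚ n) (sym (ι-^ 2 n)) ⟩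
    ι (2 ℕ.^ n) * ½ ^ℚ n       ∎

  divide-by-2^n : ∀ n H → H ℕ.+ 2 ℕ.^ n ≡ 2 ℕ.* 3 ℕ.^ n →
    ι H * ½ ^ℚ n ≡ ι 2 * (+ 3 / 2) ^ℚ n - 1ℚ
  divide-by-2^n n H H+2ⁿ≡2·3ⁿ = begin
    ι H * w                                        ≡⟨ cong (_* w) ιH≡2·3ⁿ-2ⁿ ⟩
    (ι 2 * ι (3 ℕ.^ n) - ι (2 ℕ.^ n)) * w          ≡⟨ distribute (ι 2) (ι (3 ℕ.^ n)) (ι (2 ℕ.^ n)) w ⟩
    ι 2 * (ι (3 ℕ.^ n) * w) - ι (2 ℕ.^ n) * w      ≡⟨ cong₂ (λ x y → ι 2 * x - y) (sym ([3/2]^n n)) (sym (1≡2^n[½]^n n)) ⟩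
    ι 2 * (+ 3 / 2) ^ℚ n - 1ℚ                      ∎
    where
    w = ½ ^ℚ n
    ιH≡2·3ⁿ-2ⁿ : ι H ≡ ι 2 * ι (3 ℕ.^ n) - ι (2 ℕ.^ n)
    ιH≡2·3ⁿ-2ⁿ = begin
      ι H                                  ≡⟨ solve 2 (λ h p → h := (h :+ p) :- p) refl (ι H) (ι (2 ℕ.^ n)) ⟩
      (ι H + ι (2 ℕ.^ n)) - ι (2 ℕ.^ n)    ≡⟨ cong (_- ι (2 ℕ.^ n)) (sym (ι-+ H (2 ℕ.^ n))) ⟩
      ι (H ℕ.+ 2 ℕ.^ n) - ι (2 ℕ.^ n)      ≡⟨ cong (λ m → ι m - ι (2 ℕ.^ n)) H+2ⁿ≡2·3ⁿ ⟩
      ι (2 ℕ.* 3 ℕ.^ n) - ι (2 ℕ.^ n)      ≡⟨ cong (_- ι (2 ℕ.^ n)) (ι-* 2 (3 ℕ.^ n)) ⟩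
      ι 2 * ι (3 ℕ.^ n) - ι (2 ℕ.^ n)      ∎
    distribute : ∀ a x y z → (a * x - y) * z ≡ a * (x * z) - y * z
    distribute = solve 4 (λ a x y z → (a :* x :- y) :* z := a :* (x :* z) :- y :* z) refl

open import Defs
open import Data.Nat using (ℕ)
open import Data.Integer using (+_)
open import Data.Rational using (ℚ; 1ℚ; _*_; _-_; _/_)
open import Relation.Binary.PropositionalEquality using (_≡_; cong; module ≡-Reasoning)

theorem3 : (n : ℕ) →
    expectUniform n numDistinctSubseq ≡ ((+ 2 / 1) * ((+ 3 / 2) ^ℚ n)) - 1ℚ
theorem3 n = begin
  expectUniform n numDistinctSubseq       ≡⟨ cong (λ m → ι m * ½ ^ℚ n) (∑-numDistinctSubseq n) ⟩
  ι (W n) * ½ ^ℚ n                        ≡⟨ divide-by-2^n n (W n) (W-closed n) ⟩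
  ((+ 2 / 1) * ((+ 3 / 2) ^ℚ n)) - 1ℚ     ∎
  where
  open ≡-Reasoning
  open Counting using (W; ∑-numDistinctSubseq)
  open Closed-form using (W-closed)
  open Rationals using (ι; ½; divide-by-2^n)
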